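{- Let $a,b,c$ be distinct elements of $\mathbb{Z}_6$. Then at least one of the elements $2(a+b+c)$, $2a+b+3c$, $2b+c+3a$, $a+2b+3c$, $2a+c+3b$, $a+2c+3b$, $b+2c+3a$ is $0$ in $\mathbb{Z}_6$.
   Context: Here $a,b,c$ are the first coordinates (row values) of three distinct rows of $\mathbb{Z}_6^2$. -}

module Defs where

open import Data.Nat using (ℕ; _+_; _*_; _%_)
open import Data.Fin using (Fin; toℕ; fromℕ<)
open import Data.Nat.DivMod using (m%n<n)

ℤ₆ : Set
ℤ₆ = Fin 6

infixl 6 _⊕_
infixl 7 _·_

_⊕_ : ℤ₆ → ℤ₆ → ℤ₆
a ⊕ b = fromℕ< (m%n<n (toℕ a + toℕ b) 6)

_·_ : ℕ → ℤ₆ → ℤ₆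
k · a = fromℕ< (m%n<n (k * toℕ a) 6)

module Submission where

open import Defs
open import Data.Fin using (zero)
open import Data.Fin.Properties using (_≟_; all?)
open import Data.Sum using (_⊎_)
open import Relation.Nullary.Decidable using (Dec; toWitness; _⊎-dec_; _→-dec_; ¬?)
open import Relation.Binary.PropositionalEquality using (_≡_; _≢_)

SomeFormVanishes : ℤ₆ → ℤ₆ → ℤ₆ → Set
SomeFormVanishes a b c =
  (2 · (a ⊕ b ⊕ c) ≡ zero) ⊎ (2 · a ⊕ b ⊕ 3 · c ≡ zero) ⊎
  (2 · b ⊕ c ⊕ 3 · a ≡ zero) ⊎ (a ⊕ 2 · b ⊕ 3 · c ≡ zero) ⊎
  (2 · a ⊕ c ⊕ 3 · b ≡ zero) ⊎ (a ⊕ 2 · c ⊕ 3 · b ≡ zero) ⊎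
  (b ⊕ 2 · c ⊕ 3 · a ≡ zero)

someFormVanishes? : ∀ a b c → Dec (SomeFormVanishes a b c)
someFormVanishes? a b c =
  (2 · (a ⊕ b ⊕ c) ≟ zero) ⊎-dec (2 · a ⊕ b ⊕ 3 · c ≟ zero) ⊎-dec
  (2 · b ⊕ c ⊕ 3 · a ≟ zero) ⊎-dec (a ⊕ 2 · b ⊕ 3 · c ≟ zero) ⊎-dec
  (2 · a ⊕ c ⊕ 3 · b ≟ zero) ⊎-dec (a ⊕ 2 · c ⊕ 3 · b ≟ zero) ⊎-dec
  (b ⊕ 2 · c ⊕ 3 · a ≟ zero)

distinct⇒someFormVanishes? :
  Dec (∀ a b c → a ≢ b → b ≢ c → a ≢ c → SomeFormVanishes a b c)
distinct⇒someFormVanishes? =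
  all? λ a → all? λ b → all? λ c →
    ¬? (a ≟ b) →-dec ¬? (b ≟ c) →-dec ¬? (a ≟ c) →-dec someFormVanishes? a b c

proposition4p2 : (a b c : ℤ₆) → a ≢ b → b ≢ c → a ≢ c →
    (2 · (a ⊕ b ⊕ c) ≡ zero) ⊎ (2 · a ⊕ b ⊕ 3 · c ≡ zero) ⊎
    (2 · b ⊕ c ⊕ 3 · a ≡ zero) ⊎ (a ⊕ 2 · b ⊕ 3 · c ≡ zero) ⊎
    (2 · a ⊕ c ⊕ 3 · b ≡ zero) ⊎ (a ⊕ 2 · c ⊕ 3 · b ≡ zero) ⊎
    (b ⊕ 2 · c ⊕ 3 · a ≡ zero)
proposition4p2 = toWitness {a? = distinct⇒someFormVanishes?} _
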